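{- Let $X$ and $Y$ be any two of the six directed settings D \& strict, D \& strict \& simple, D \& non-strict, D \& non-strict \& simple, D \& proper, D \& proper \& simple. Then for every temporal graph $\mathcal{G}_1$ in $X$ there is a temporal graph $\mathcal{G}_2$ in $Y$ that is induced-reachability equivalent to $\mathcal{G}_1$, i.e. $V(\mathcal{G}_1)\subseteq V(\mathcal{G}_2)$ and $\mathcal{R}(\mathcal{G}_1)\simeq\mathcal{R}(\mathcal{G}_2)[V(\mathcal{G}_1)]$ (each reachability graph computed in its own setting). That is, all directed settings are induced-reachability equivalent.
   Context: A directed temporal graph is a triple $(V,E,\lambda)$ with $V$ finite, $E\subseteq\{(u,v)\in V\times V:u\ne v\}$, and $\lambda$ assigning each arc a nonempty finite set of time labels; it is simple if every arc has exactly one label, and proper if no two distinct arcs incident to a common vertex share a label. A temporal path from $u$ to $v$ is a sequence $(e_1,t_1),\dots,(e_k,t_k)$, $k\ge1$, $t_i\in\lambda(e_i)$, with $e_1,\dots,e_k$ a directed path from $u$ to $v$ (distinct vertices) and $t_1\le\dots\le t_k$; it is strict if $t_1<\dots<t_k$. Settings: D \& strict = directed temporal graphs with reachability via strict paths; D \& non-strict = directed temporal graphs with reachability via all temporal paths; adding "\& simple" restricts to simple graphs; D \& proper = proper directed temporal graphs (where strict and non-strict coincide); D \& proper \& simple = proper simple ones. The reachability graph $\mathcal{R}(\mathcal{G})$ is the static directed graph on $V$ with arc $(u,v)$, $u\ne v$, iff there is a temporal path of the setting's kind from $u$ to $v$; $\mathcal{R}(\mathcal{G}_2)[V(\mathcal{G}_1)]$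 is its induced subgraph on $V(\mathcal{G}_1)$. -}

module Defs where

open import Data.Nat using (ℕ; _≤_; _<_)
open import Data.Fin using (Fin)
open import Data.List using (List; []; _∷_)
open import Data.List.Membership.Propositional using (_∈_)
open import Data.List.Relation.Unary.Unique.Propositional using (Unique)
open import Data.Product using (Σ; _×_; _,_; ∃)
open import Data.Sum using (_⊎_)
open import Data.Unit using (⊤)
open import Data.Empty using (⊥)
open import Relation.Nullary using (¬_)
open import Relation.Binary.PropositionalEquality using (_≡_; _≢_)
open import Function.Definitions using (Injective)

-- A directed temporal graph on vertex set Fin n.
-- lab u v is the (finite) set of time labels of the arc (u,v), given as a list;
-- (u,v) is an arc iff lab u v is nonempty (so every arc has a nonempty finite
-- label set).
record TGraph : Set where
  field
    n      : ℕ
    lab    : Fin n → Fin n → List ℕ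
    noLoop : ∀ u → lab u u ≡ []
open TGraph public

Simple : TGraph → Set
Simple G = ∀ u v t t' → t ∈ lab G u v → t' ∈ lab G u v → t ≡ t'

Proper : TGraph → Set
Proper G = ∀ a b c d → ¬ (a ≡ c × b ≡ d)
  → (a ≡ c ⊎ a ≡ d ⊎ b ≡ c ⊎ b ≡ d)
  → ∀ t → t ∈ lab G a b → t ∈ lab G c d → ⊥

-- TPath G R u v t vs : a temporal path from u to v whose first time label is t,
-- visiting the vertex sequence vs, consecutive labels related by R
-- (R = _<_ for strict, _≤_ for non-strict).
data TPath (G : TGraph) (R : ℕ → ℕ → Set) :
     Fin (n G) → Fin (n G) → ℕ → List (Fin (n G)) → Set where
  one  : ∀ {u v t} → t ∈ lab G u v → TPath G R u v t (u ∷ v ∷ [])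
  step : ∀ {u w v t t' vs} → t ∈ lab G u w → R t t' → TPath G R w v t' vs
       → TPath G R u v t (u ∷ vs)

data Setting : Set where
  strict strictSimple nonStrict nonStrictSimple proper properSimple : Setting

InSetting : Setting → TGraph → Set
InSetting strict          G = ⊤
InSetting strictSimple    G = Simple G
InSetting nonStrict       G = ⊤
InSetting nonStrictSimple G = Simple G
InSetting proper          G = Proper G
InSetting properSimple    G = Proper G × Simple G

-- the kind of temporal path used for reachability in a setting
-- (for proper graphs strict and non-strict coincide; we use strict)
Order : Setting → ℕ → ℕ → Set
Order strict          = _<_
Order strictSimple    = _<_
Order nonStrict       = _≤_
Order nonStrictSimple = _≤_
Order proper          = _<_
Order properSimple    = _<_

Reach : Setting → (G : TGraph) → Fin (n G) → Fin (n G) → Set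
Reach X G u v = u ≢ v × Σ ℕ λ t → Σ (List (Fin (n G))) λ vs →
  TPath G (Order X) u v t vs × Unique vs

IndReachEquiv : Setting → Setting → TGraph → TGraph → Set
IndReachEquiv X Y G1 G2 = Σ (Fin (n G1) → Fin (n G2)) λ f →
  Injective _≡_ _≡_ f ×
  (∀ u v → (Reach X G1 u v → Reach Y G2 (f u) (f v)) ×
           (Reach Y G2 (f u) (f v) → Reach X G1 u v))

{-# OPTIONS --safe #-}
module Submission where

-- Reachability in every setting is decidable (paths visit distinct vertices, so
-- a bounded search suffices), hence R(G₁) is a decidable irreflexive digraph D
-- on the vertices of G₁; membership of G₁ in X plays no further role.
-- Subdivide each arc u → v of D by a fresh vertex and label every arc x → y of
-- the subdivision by the single number combine x y, which is injective and
-- lexicographic in (x , y).  Injectivity makes the graph proper and simple.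
-- Original vertices come before subdivision vertices, so u → (u,v) → v is a
-- strictly increasing path, whereas after an arc (u,v) → v back to an original
-- vertex every further label is smaller; a temporal path between original
-- vertices is thus exactly one subdivided arc of D, in every setting.

open import Defs
open import Data.Nat as ℕ using (ℕ; zero; suc; _≤_; _<_; z≤n; s≤s; _*_)
import Data.Nat.Properties as ℕ
open import Data.Fin as Fin using (Fin; toℕ; combine)
import Data.Fin.Properties as Fin
open import Data.List using (List; []; _∷_; length; lookup)
open import Data.List.Membership.Propositional using (_∈_; lose)
open import Data.List.Membership.Propositional.Properties using (∈-lookup)
open import Data.List.Membership.DecPropositional ℕ._≟_ using (_∈?_)
open import Data.List.Relation.Unary.Any as Any using (Any; here)
import Data.List.Relation.Unary.All as All
open import Data.List.Relation.Unary.AllPairs using ([]; _∷_)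
open import Data.List.Relation.Unary.All using ([]; _∷_)
open import Data.List.Relation.Unary.Unique.Propositional using (Unique)
import Data.List.Relation.Unary.Unique.DecPropositional as UniqueDec
open import Data.Product using (Σ; ∃; ∃₂; _×_; _,_; proj₁; proj₂)
open import Data.Sum using (_⊎_; inj₁; inj₂)
open import Function using (_∘_)
open import Function.Bundles using (_⇔_; mk⇔; Equivalence)
open import Function.Definitions using (Injective)
open import Level using (0ℓ)
open import Relation.Binary using (Rel; Decidable)
import Relation.Unary as U
open import Relation.Nullary using (¬_; Dec; yes; no; contradiction)
open import Relation.Nullary.Decidable using (map′; _×-dec_; _⊎-dec_; ¬?)
open import Relation.Binary.PropositionalEquality
  using (_≡_; _≢_; refl; sym; trans; cong; subst; subst₂)

private variable
  m : ℕ

Order? : ∀ X → Decidable (Order X)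
Order? strict          = ℕ._<?_
Order? strictSimple    = ℕ._<?_
Order? nonStrict       = ℕ._≤?_
Order? nonStrictSimple = ℕ._≤?_
Order? proper          = ℕ._<?_
Order? properSimple    = ℕ._<?_

Order⇒≤ : ∀ X {a b} → Order X a b → a ≤ b
Order⇒≤ strict          = ℕ.<⇒≤
Order⇒≤ strictSimple    = ℕ.<⇒≤
Order⇒≤ nonStrict       = λ a≤b → a≤b
Order⇒≤ nonStrictSimple = λ a≤b → a≤b
Order⇒≤ proper          = ℕ.<⇒≤
Order⇒≤ properSimple    = ℕ.<⇒≤

<⇒Order : ∀ X {a b} → a < b → Order X a b
<⇒Order strict          = λ a<b → a<b
<⇒Order strictSimple    = λ a<b → a<b
<⇒Order nonStrict       = ℕ.<⇒≤
<⇒Order nonStrictSimple = ℕ.<⇒≤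
<⇒Order proper          = λ a<b → a<b
<⇒Order properSimple    = λ a<b → a<b

proper∧simple⇒InSetting : ∀ X {G} → Proper G → Simple G → InSetting X G
proper∧simple⇒InSetting strict          _ _ = _
proper∧simple⇒InSetting strictSimple    _ s = s
proper∧simple⇒InSetting nonStrict       _ _ = _
proper∧simple⇒InSetting nonStrictSimple _ s = s
proper∧simple⇒InSetting proper          p _ = p
proper∧simple⇒InSetting properSimple    p s = p , s

module _ {G : TGraph} {R : ℕ → ℕ → Set} where

  source≡head : ∀ {u v t x vs} → TPath G R u v t (x ∷ vs) → u ≡ x
  source≡head (one _)      = refl
  source≡head (step _ _ _) = refl

  first-label : ∀ {u v t x y vs} → TPath G R u v t (x ∷ y ∷ vs) → t ∈ lab G u y
  first-label (one t∈)                                = t∈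
  first-label (step t∈ _ p) with refl ← source≡head p = t∈

  first-arc : ∀ {u v t vs} → TPath G R u v t vs → ∃ λ y → t ∈ lab G u y
  first-arc (one t∈)      = _ , t∈
  first-arc (step t∈ _ _) = _ , t∈

  one⁻¹ : ∀ {u v t x y} → TPath G R u v t (x ∷ y ∷ []) → x ≡ u × y ≡ v × t ∈ lab G u v
  one⁻¹ (one t∈) = refl , refl , t∈
  one⁻¹ (step _ _ (step _ _ ()))

  step⁻¹ : ∀ {u v t x y z vs} → TPath G R u v t (x ∷ y ∷ z ∷ vs) →
           x ≡ u × t ∈ lab G u y ×
           Any (λ t′ → R t t′ × TPath G R y v t′ (y ∷ z ∷ vs)) (lab G y z)
  step⁻¹ (step t∈ r p) with refl ← source≡head p = refl , t∈ , lose (first-label p) (r , p)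

  module _ (R? : Decidable R) where

    TPath? : ∀ u v t vs → Dec (TPath G R u v t vs)
    TPath? u v t []           = no λ ()
    TPath? u v t (x ∷ [])     = no λ { (step _ _ ()) }
    TPath? u v t (x ∷ y ∷ []) =
      map′ (λ { (refl , refl , t∈) → one t∈ }) one⁻¹
           (x Fin.≟ u ×-dec y Fin.≟ v ×-dec t ∈? lab G u v)
    TPath? u v t (x ∷ vs@(y ∷ z ∷ _)) =
      map′ (λ { (refl , t∈ , later) → let (_ , r , p) = Any.satisfied later in step t∈ r p })
           step⁻¹
           (x Fin.≟ u ×-dec t ∈? lab G u y ×-dec
            Any.any? (λ t′ → R? t t′ ×-dec TPath? y v t′ vs) (lab G y z))

    ∃TPath? : ∀ u v vs → Dec (∃ λ t → TPath G R u v t vs)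
    ∃TPath? u v []             = no λ ()
    ∃TPath? u v (x ∷ [])       = no λ { (_ , step _ _ ()) }
    ∃TPath? u v vs@(x ∷ y ∷ _) =
      map′ Any.satisfied (λ (_ , p) → lose (first-label p) p)
           (Any.any? (λ t → TPath? u v t vs) (lab G u y))

lookup-injective : {A : Set} {xs : List A} → Unique xs → Injective _≡_ _≡_ (lookup xs)
lookup-injective {xs = _ ∷ _} (_  ∷ _)  {Fin.zero}  {Fin.zero}  _  = refl
lookup-injective {xs = _ ∷ _} (x∉ ∷ _)  {Fin.zero}  {Fin.suc j} eq =
  contradiction eq (All.lookup x∉ (∈-lookup j))
lookup-injective {xs = _ ∷ _} (x∉ ∷ _)  {Fin.suc i} {Fin.zero}  eq =
  contradiction (sym eq) (All.lookup x∉ (∈-lookup i))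
lookup-injective {xs = _ ∷ _} (_  ∷ uq) {Fin.suc i} {Fin.suc j} eq =
  cong Fin.suc (lookup-injective uq eq)

Unique⇒length≤ : {xs : List (Fin m)} → Unique xs → length xs ≤ m
Unique⇒length≤ uq = Fin.injective⇒≤ (lookup-injective uq)

∃-length≤? : ∀ k {P : List (Fin m) → Set} → U.Decidable P →
             Dec (∃ λ xs → length xs ≤ k × P xs)
∃-length≤? zero    P? = map′ (λ p → [] , z≤n , p) (λ { ([] , _ , p) → p }) (P? [])
∃-length≤? (suc k) P? =
  map′ (λ { (inj₁ p) → [] , z≤n , p ; (inj₂ (x , xs , l , p)) → x ∷ xs , s≤s l , p })
       (λ { ([] , _ , p) → inj₁ p ; (x ∷ xs , s≤s l , p) → inj₂ (x , xs , l , p) })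
       (P? [] ⊎-dec Fin.any? (λ x → ∃-length≤? k (P? ∘ (x ∷_))))

Reach? : ∀ X G → Decidable (Reach X G)
Reach? X G u v = ¬? (u Fin.≟ v) ×-dec
  map′ (λ (vs , _ , (t , p) , uq) → t , vs , p , uq)
       (λ (t , vs , p , uq) → vs , Unique⇒length≤ uq , (t , p) , uq)
       (∃-length≤? (n G) λ vs →
          ∃TPath? (Order? X) u v vs ×-dec UniqueDec.unique? Fin._≟_ vs)

module CodeLabelled {A : Rel (Fin m) 0ℓ} (A? : Decidable A) (A-irrefl : ∀ {x} → ¬ A x x) where

  code : Fin m → Fin m → ℕ
  code x y = toℕ (combine x y)

  labels : Fin m → Fin m → List ℕ
  labels x y with A? x y
  ... | yes _ = code x y ∷ []
  ... | no  _ = []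

  labels-irrefl : ∀ x → labels x x ≡ []
  labels-irrefl x with A? x x
  ... | yes a = contradiction a A-irrefl
  ... | no  _ = refl

  graph : TGraph
  graph = record { n = m ; lab = labels ; noLoop = labels-irrefl }

  ∈-labels⁻ : ∀ {x y t} → t ∈ labels x y → A x y × t ≡ code x y
  ∈-labels⁻ {x} {y} t∈ with A? x y | t∈
  ... | yes a | here t≡ = a , t≡

  ∈-labels⁺ : ∀ {x y} → A x y → code x y ∈ labels x y
  ∈-labels⁺ {x} {y} a with A? x y
  ... | yes _ = here refl
  ... | no ¬a = contradiction a ¬a

  graph-simple : Simple graph
  graph-simple _ _ _ _ t∈ t′∈ = trans (proj₂ (∈-labels⁻ t∈)) (sym (proj₂ (∈-labels⁻ t′∈)))

  graph-proper : Proper graph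
  graph-proper a b c d ab≢cd _ _ t∈ t∈′ = ab≢cd (Fin.combine-injective a b c d
    (Fin.toℕ-injective (trans (sym (proj₂ (∈-labels⁻ t∈))) (proj₂ (∈-labels⁻ t∈′)))))

  consecutive-labels-ascend : ∀ {x y z t t′} → t ∈ labels x y → t′ ∈ labels y z → t ≤ t′ → ¬ y Fin.< x
  consecutive-labels-ascend {x} {y} {z} t∈ t′∈ t≤t′ y<x = ℕ.<⇒≱ (Fin.combine-monoˡ-< z y y<x)
    (subst₂ _≤_ (proj₂ (∈-labels⁻ t∈)) (proj₂ (∈-labels⁻ t′∈)) t≤t′)

module Subdivision {n} {D : Rel (Fin n) 0ℓ} (D? : Decidable D) (D-irrefl : ∀ {u v} → D u v → u ≢ v) where

  orig : Fin n → Fin (suc n * n)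
  orig v = combine {suc n} Fin.zero v

  mid : Fin n → Fin n → Fin (suc n * n)
  mid u v = combine (Fin.suc u) v

  orig-injective : Injective _≡_ _≡_ orig
  orig-injective {u} {v} = Fin.combine-injectiveʳ {suc n} Fin.zero u Fin.zero v

  orig<mid : ∀ w u v → orig w Fin.< mid u v
  orig<mid w u v = Fin.combine-monoˡ-< {i = Fin.zero {n}} w v (s≤s z≤n)

  orig≢mid : ∀ w u v → orig w ≢ mid u v
  orig≢mid w u v = Fin.<⇒≢ (orig<mid w u v)

  Arc : Rel (Fin (suc n * n)) 0ℓ
  Arc x y = ∃₂ λ u v → D u v × (x ≡ orig u × y ≡ mid u v ⊎ x ≡ mid u v × y ≡ orig v)

  Arc? : Decidable Arc
  Arc? x y = Fin.any? λ u → Fin.any? λ v → D? u v ×-dec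
    ((x Fin.≟ orig u ×-dec y Fin.≟ mid u v) ⊎-dec (x Fin.≟ mid u v ×-dec y Fin.≟ orig v))

  Arc-irrefl : ∀ {x} → ¬ Arc x x
  Arc-irrefl (u , v , _ , inj₁ (refl , x≡)) = orig≢mid u u v x≡
  Arc-irrefl (u , v , _ , inj₂ (refl , x≡)) = orig≢mid v u v (sym x≡)

  open CodeLabelled Arc? Arc-irrefl public

  Arc-from-orig : ∀ {u y} → Arc (orig u) y → ∃ λ v → D u v × y ≡ mid u v
  Arc-from-orig {u} (a , v , d , inj₁ (ou≡oa , refl)) with refl ← orig-injective {u} {a} ou≡oa =
    v , d , refl
  Arc-from-orig (a , b , _ , inj₂ (ou≡mab , _)) = contradiction ou≡mab (orig≢mid _ a b)

  Arc-from-mid : ∀ {u v y} → Arc (mid u v) y → y ≡ orig v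
  Arc-from-mid (a , _ , _ , inj₁ (muv≡oa , _)) = contradiction (sym muv≡oa) (orig≢mid a _ _)
  Arc-from-mid {u} {v} (a , b , _ , inj₂ (muv≡mab , refl)) =
    cong orig (sym (Fin.combine-injectiveʳ (Fin.suc u) v (Fin.suc a) b muv≡mab))

  module _ (Y : Setting) where

    reach⁺ : ∀ {u v} → D u v → Reach Y graph (orig u) (orig v)
    reach⁺ {u} {v} d =
      ou≢ov , _ , _ , step (∈-labels⁺ enter) enter<leave (one (∈-labels⁺ leave)) , unique
      where
      enter : Arc (orig u) (mid u v)
      enter = u , v , d , inj₁ (refl , refl)
      leave : Arc (mid u v) (orig v)
      leave = u , v , d , inj₂ (refl , refl)
      enter<leave : Order Y (code (orig u) (mid u v)) (code (mid u v) (orig v))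
      enter<leave = <⇒Order Y (Fin.combine-monoˡ-< _ _ (orig<mid u u v))
      ou≢ov : orig u ≢ orig v
      ou≢ov = D-irrefl d ∘ orig-injective
      unique : Unique (orig u ∷ mid u v ∷ orig v ∷ [])
      unique = (orig≢mid u u v ∷ ou≢ov ∷ []) ∷ (orig≢mid v u v ∘ sym ∷ []) ∷ [] ∷ []

    reach⁻ : ∀ {u v t vs} → TPath graph (Order Y) (orig u) (orig v) t vs → D u v
    reach⁻ (one t∈) with _ , _ , ov≡ ← Arc-from-orig (proj₁ (∈-labels⁻ t∈)) =
      contradiction ov≡ (orig≢mid _ _ _)
    reach⁻ {u} {v} (step t∈ _ p) with w , d , refl ← Arc-from-orig {u} (proj₁ (∈-labels⁻ t∈)) =
      leave-once p
      where
      leave-once : ∀ {t vs} → TPath graph (Order Y) (mid u w) (orig v) t vs → D u v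
      leave-once (one t∈′) =
        subst (D u) (orig-injective (sym (Arc-from-mid (proj₁ (∈-labels⁻ t∈′))))) d
      leave-once (step t∈′ r q) with refl ← Arc-from-mid (proj₁ (∈-labels⁻ t∈′)) =
        contradiction (orig<mid w u w) (consecutive-labels-ascend t∈′ (proj₂ (first-arc q)) (Order⇒≤ Y r))

    reach⇔ : ∀ {u v} → Reach Y graph (orig u) (orig v) ⇔ D u v
    reach⇔ = mk⇔ (λ (_ , _ , _ , p , _) → reach⁻ p) reach⁺

corollary21 : (X Y : Setting) → (G1 : TGraph) → InSetting X G1 →
    Σ TGraph (λ G2 → InSetting Y G2 × IndReachEquiv X Y G1 G2)
corollary21 X Y G1 _ =
  graph , proper∧simple⇒InSetting Y graph-proper graph-simple ,
  orig , orig-injective , λ _ _ → Equivalence.from (reach⇔ Y) , Equivalence.to (reach⇔ Y)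
  where open Subdivision (Reach? X G1) proj₁
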